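{- Let $G$ be a finite simple triangle-free graph without isolated vertices that has a maximum open packing (i.e., an open packing of size $\rho_o(G)$) inducing a subgraph all of whose components are isomorphic to $K_2$, and let $H$ be a finite simple bipartite graph of order at least two without vertices of degree 0. Then $$\gamma_{tR}(G\times H)\ge \rho_o(G)\gamma_{tR}(H).$$
   Context: An open packing of $G$ is a set $D\subseteq V(G)$ with $N(u)\cap N(v)=\emptyset$ for all distinct $u,v\in D$ ($N(\cdot)$ the open neighborhood); $\rho_o(G)$ is the maximum size of an open packing. A function $f:V(G)\to\{0,1,2\}$ with $V_i=f^{ -1}(i)$ is a total Roman dominating function if every vertex in $V_0$ has a neighbor in $V_2$ and the subgraph induced by $V_1\cup V_2$ has no isolated vertices; $\gamma_{tR}(G)$ is the minimum of $\sum_v f(v)$ over such $f$. The direct product $G\times H$ has vertex set $V(G)\times V(H)$, with $(g,h)(g',h')$ an edge iff $gg'\in E(G)$ and $hh'\in E(H)$. -}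

module Defs where

open import Data.Nat using (ℕ; _+_; _*_; _≤_)
open import Data.Fin using (Fin; toℕ; remQuot)
open import Data.Fin.Subset using (Subset; _∈_; ∣_∣)
open import Data.Bool using (Bool)
open import Data.Product using (Σ; _×_; _,_; proj₁; proj₂; ∃)
open import Data.Empty using (⊥)
open import Data.Vec.Functional using (foldr)
open import Relation.Nullary using (¬_)
open import Relation.Binary.PropositionalEquality using (_≡_; _≢_)

record Graph : Set₁ where
  field
    n     : ℕ
    Adj   : Fin n → Fin n → Set
    sym   : ∀ {u v} → Adj u v → Adj v u
    irrefl : ∀ {u} → ¬ Adj u u
open Graph public

-- Direct (tensor) product G × H, vertex set Fin (n G * n H) ≅ Fin (n G) × Fin (n H)
-- via remQuot.
fstV : ∀ a b → Fin (a * b) → Fin a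
fstV a b x = proj₁ (remQuot {a} b x)

sndV : ∀ a b → Fin (a * b) → Fin b
sndV a b x = proj₂ (remQuot {a} b x)

_×ᵍ_ : Graph → Graph → Graph
G ×ᵍ H = record
  { n = n G * n H
  ; Adj = λ x y → Adj G (fstV (n G) (n H) x) (fstV (n G) (n H) y)
                 × Adj H (sndV (n G) (n H) x) (sndV (n G) (n H) y)
  ; sym = λ { (a , b) → Graph.sym G a , Graph.sym H b }
  ; irrefl = λ { (a , b) → Graph.irrefl G a }
  }

TriangleFree : Graph → Set
TriangleFree G = ∀ u v w → Adj G u v → Adj G v w → Adj G u w → ⊥

NoIsolated : Graph → Set
NoIsolated G = ∀ v → ∃ λ u → Adj G v u

Bipartite : Graph → Set
Bipartite G = Σ (Fin (n G) → Bool) λ c → ∀ u v → Adj G u v → c u ≢ c v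

OpenPacking : (G : Graph) → Subset (n G) → Set
OpenPacking G D = ∀ u v → u ∈ D → v ∈ D → u ≢ v → ∀ w → ¬ (Adj G u w × Adj G v w)

Isρo : (G : Graph) → ℕ → Set
Isρo G p = (Σ (Subset (n G)) λ D → OpenPacking G D × ∣ D ∣ ≡ p)
         × (∀ D → OpenPacking G D → ∣ D ∣ ≤ p)

-- Every component of G[D] is isomorphic to K₂, i.e. each vertex of D has
-- exactly one neighbour in D.
InducesK₂Components : (G : Graph) → Subset (n G) → Set
InducesK₂Components G D =
  ∀ u → u ∈ D → Σ (Fin (n G)) λ v → v ∈ D × Adj G u v
                 × (∀ w → w ∈ D → Adj G u w → w ≡ v)

IsTRDF : (G : Graph) → (Fin (n G) → Fin 3) → Set
IsTRDF G f =
  (∀ v → toℕ (f v) ≡ 0 → Σ (Fin (n G)) λ u → Adj G v u × toℕ (f u) ≡ 2)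
  × (∀ v → toℕ (f v) ≢ 0 → Σ (Fin (n G)) λ u → Adj G v u × toℕ (f u) ≢ 0)

weight : (G : Graph) → (Fin (n G) → Fin 3) → ℕ
weight G f = foldr (λ a b → toℕ a + b) 0 f

IsγtR : (G : Graph) → ℕ → Set
IsγtR G k = (Σ (Fin (n G) → Fin 3) λ f → IsTRDF G f × weight G f ≡ k)
          × (∀ f → IsTRDF G f → k ≤ weight G f)

-- Let f be a total Roman dominating function (TRDF) of G × H, let c be a
-- proper 2-colouring of H, and let x ∈ D with partner x' (its neighbour in D).
-- On layer h put the "centre" at x if c h holds and at x' otherwise, and let
-- g(h) = min(2, mass_x(h)), where mass_x(h) is the total f-value of the
-- G-neighbourhood of the centre inside layer h.
-- Adjacent layers have swapped centres, which makes g a TRDF of H; hence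
-- γtR(H) ≤ w(g) ≤ Σ_h mass_x(h).  For a fixed layer the centres of distinct
-- x ∈ D are distinct members of D, so their neighbourhoods are disjoint by the
-- packing property and Σ_{x ∈ D} mass_x(h) is at most the f-weight of layer h.
-- Summing over the layers gives |D| · γtR(H) ≤ w(f).
--
-- Adjacency is not assumed decidable; since the conclusion is a
-- decidable inequality, decidability of adjacency may be assumed classically
-- (it is not refutable for finitely many instances).

module Submission where

open import Defs hiding (sym)
open import Data.Nat using (ℕ; zero; suc; _+_; _*_; _≤_; z≤n; s≤s; _≤?_) renaming (_≟_ to _≟ℕ_)
open import Data.Nat.Properties
  using ( +-*-semiring; +-assoc; +-identityʳ; +-mono-≤; *-monoˡ-≤; *-identityˡ; *-assoc; *-monoʳ-≤
        ; ≤-trans; ≤-reflexive; m≤m+n; m≤n+m; n≤0⇒n≡0; n≢0⇒n>0; 0≢1+n; module ≤-Reasoning)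
open import Data.Fin using (Fin; zero; suc; toℕ; combine; _↑ˡ_; _↑ʳ_; _≟_)
open import Data.Fin.Properties using (remQuot-combine; combine-remQuot; sequence)
import Data.Fin.Properties as FinP
open import Data.Fin.Subset using (Subset; _∈_; ∣_∣; inside; outside)
open import Data.Fin.Subset.Properties using (_∈?_)
open import Data.Vec using ([]; _∷_)
open import Data.Vec.Functional using (foldr)
open import Data.Bool using (Bool; true; false; if_then_else_)
open import Data.Product using (Σ; _×_; _,_; proj₁; proj₂)
open import Function using (_∘_)
open import Effect.Monad using (RawMonad)
open import Relation.Nullary using (¬_; Dec; yes; no; does; _×-dec_)
open import Relation.Nullary.Negation using (¬¬-Monad; contradiction)
open import Relation.Nullary.Decidable using (¬¬-excluded-middle; decidable-stable)
open import Relation.Binary.PropositionalEquality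
  using (_≡_; _≢_; refl; sym; trans; cong; subst; subst₂)

open import Algebra.Properties.Semiring.Sum +-*-semiring
  using (sum; sum-cong-≗; sum-replicate-zero; ∑-comm; *-distribˡ-sum; *-distribʳ-sum)

sum-mono : ∀ {n} {φ ψ : Fin n → ℕ} → (∀ i → φ i ≤ ψ i) → sum φ ≤ sum ψ
sum-mono {zero}  _  = z≤n
sum-mono {suc n} le = +-mono-≤ (le zero) (sum-mono (le ∘ suc))

term≤sum : ∀ {n} (φ : Fin n → ℕ) i → φ i ≤ sum φ
term≤sum φ zero    = m≤m+n (φ zero) _
term≤sum φ (suc i) = ≤-trans (term≤sum (φ ∘ suc) i) (m≤n+m _ (φ zero))

sum-blocks : ∀ b c (φ : Fin (b + c) → ℕ) →
  sum φ ≡ sum (λ i → φ (i ↑ˡ c)) + sum (λ j → φ (b ↑ʳ j))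
sum-blocks zero    c φ = refl
sum-blocks (suc b) c φ =
  trans (cong (φ zero +_) (sum-blocks b c (φ ∘ suc))) (sym (+-assoc (φ zero) _ _))

sum-combine : ∀ a b (φ : Fin (a * b) → ℕ) →
  sum φ ≡ sum (λ y → sum (λ h → φ (combine {a} {b} y h)))
sum-combine zero    b φ = refl
sum-combine (suc a) b φ =
  trans (sum-blocks b (a * b) φ)
        (cong (sum (λ h → φ (h ↑ˡ (a * b))) +_) (sum-combine a b (λ z → φ (b ↑ʳ z))))

weight≡sum : ∀ {n} (f : Fin n → Fin 3) → foldr (λ a w → toℕ a + w) 0 f ≡ sum (toℕ ∘ f)
weight≡sum {zero}  f = refl
weight≡sum {suc n} f = cong (toℕ (f zero) +_) (weight≡sum (f ∘ suc))

𝟙 : {P : Set} → Dec P → ℕ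
𝟙 d = if does d then 1 else 0

𝟙-weighted : ∀ {P : Set} (d : Dec P) {w : ℕ} → P → w ≤ 𝟙 d * w
𝟙-weighted (yes _) {w} _ = m≤m+n w 0
𝟙-weighted (no ¬p)     p = contradiction p ¬p

𝟙-mono : ∀ {P : Set} (d : Dec P) {u v : ℕ} → (P → u ≤ v) → 𝟙 d * u ≤ 𝟙 d * v
𝟙-mono (yes p) le = *-monoʳ-≤ 1 (le p)
𝟙-mono (no _)  le = z≤n

𝟙-× : ∀ {P Q : Set} (d : Dec P) (e : Dec Q) → 𝟙 (d ×-dec e) ≡ 𝟙 d * 𝟙 e
𝟙-× (yes _) e = sym (+-identityʳ (𝟙 e))
𝟙-× (no _)  e = refl

card≡sum : ∀ {n} (D : Subset n) → ∣ D ∣ ≡ sum (λ x → 𝟙 (x ∈? D))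
card≡sum []            = refl
card≡sum (inside  ∷ D) = cong suc (card≡sum D)
card≡sum (outside ∷ D) = card≡sum D

sum-𝟙-none : ∀ {n} {Q : Fin n → Set} (Q? : ∀ i → Dec (Q i)) → (∀ i → ¬ Q i) →
  sum (λ i → 𝟙 (Q? i)) ≡ 0
sum-𝟙-none {n} Q? none = trans (sum-cong-≗ false-everywhere) (sum-replicate-zero n)
  where
  false-everywhere : ∀ i → 𝟙 (Q? i) ≡ 0
  false-everywhere i with Q? i
  ... | yes q = contradiction q (none i)
  ... | no _  = refl

sum-𝟙-≤1 : ∀ {n} {Q : Fin n → Set} (Q? : ∀ i → Dec (Q i)) →
  (∀ i j → Q i → Q j → i ≡ j) → sum (λ i → 𝟙 (Q? i)) ≤ 1
sum-𝟙-≤1 {zero}  Q? unique = z≤n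
sum-𝟙-≤1 {suc n} Q? unique with Q? zero
... | yes q₀ = ≤-reflexive (cong suc (sum-𝟙-none (Q? ∘ suc)
                 (λ i qᵢ → FinP.0≢1+n (unique zero (suc i) q₀ qᵢ))))
... | no _   = sum-𝟙-≤1 (Q? ∘ suc) (λ i j qᵢ qⱼ → FinP.suc-injective (unique (suc i) (suc j) qᵢ qⱼ))

disjoint-sum : ∀ {m n} {P : Fin m → Set} {S : Fin m → Fin n → Set}
  (P? : ∀ x → Dec (P x)) (S? : ∀ x y → Dec (S x y)) (w : Fin n → ℕ) →
  (∀ x x' y → P x → P x' → S x y → S x' y → x ≡ x') →
  sum (λ x → 𝟙 (P? x) * sum (λ y → 𝟙 (S? x y) * w y)) ≤ sum w
disjoint-sum P? S? w disjoint = begin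
    sum (λ x → 𝟙 (P? x) * sum (λ y → 𝟙 (S? x y) * w y))
  ≡⟨ sum-cong-≗ (λ x → *-distribˡ-sum (𝟙 (P? x)) (λ y → 𝟙 (S? x y) * w y)) ⟩
    sum (λ x → sum (λ y → 𝟙 (P? x) * (𝟙 (S? x y) * w y)))
  ≡⟨ ∑-comm (λ x y → 𝟙 (P? x) * (𝟙 (S? x y) * w y)) ⟩
    sum (λ y → sum (λ x → 𝟙 (P? x) * (𝟙 (S? x y) * w y)))
  ≡⟨ sum-cong-≗ (λ y → sum-cong-≗ (λ x → merge x y)) ⟩
    sum (λ y → sum (λ x → 𝟙 (P? x ×-dec S? x y) * w y))
  ≡⟨ sum-cong-≗ (λ y → sym (*-distribʳ-sum (w y) (λ x → 𝟙 (P? x ×-dec S? x y)))) ⟩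
    sum (λ y → sum (λ x → 𝟙 (P? x ×-dec S? x y)) * w y)
  ≤⟨ sum-mono (λ y → ≤-trans (*-monoˡ-≤ (w y) (at-most-once y)) (≤-reflexive (*-identityˡ (w y)))) ⟩
    sum w ∎
  where
  open ≤-Reasoning
  merge : ∀ x y → 𝟙 (P? x) * (𝟙 (S? x y) * w y) ≡ 𝟙 (P? x ×-dec S? x y) * w y
  merge x y = trans (sym (*-assoc (𝟙 (P? x)) _ (w y))) (cong (_* w y) (sym (𝟙-× (P? x) (S? x y))))
  at-most-once : ∀ y → sum (λ x → 𝟙 (P? x ×-dec S? x y)) ≤ 1
  at-most-once y = sum-𝟙-≤1 (λ x → P? x ×-dec S? x y)
    (λ x x' (px , sx) (px' , sx') → disjoint x x' y px px' sx sx')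

cap : ℕ → Fin 3
cap zero          = zero
cap (suc zero)    = suc zero
cap (suc (suc _)) = suc (suc zero)

cap-≤ : ∀ t → toℕ (cap t) ≤ t
cap-≤ zero          = z≤n
cap-≤ (suc zero)    = s≤s z≤n
cap-≤ (suc (suc t)) = s≤s (s≤s z≤n)

cap-zero : ∀ t → toℕ (cap t) ≡ 0 → t ≡ 0
cap-zero zero          _  = refl
cap-zero (suc zero)    ()
cap-zero (suc (suc t)) ()

cap-two : ∀ t → 2 ≤ t → toℕ (cap t) ≡ 2
cap-two (suc zero)    (s≤s ())
cap-two (suc (suc t)) _ = refl

cap-positive : ∀ t → 1 ≤ t → toℕ (cap t) ≢ 0
cap-positive (suc zero)    _ ()
cap-positive (suc (suc t)) _ ()

product-neighbour : ∀ (G H : Graph) y h z → Adj (G ×ᵍ H) (combine y h) z →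
  Σ (Fin (n G)) λ y' → Σ (Fin (n H)) λ h' →
    Adj G y y' × Adj H h h' × z ≡ combine y' h'
product-neighbour G H y h z (yy' , hh') =
  fstV (n G) (n H) z , sndV (n G) (n H) z ,
  subst (λ t → Adj G (proj₁ t) (fstV (n G) (n H) z)) (remQuot-combine y h) yy' ,
  subst (λ t → Adj H (proj₂ t) (sndV (n G) (n H) z)) (remQuot-combine y h) hh' ,
  sym (combine-remQuot {n G} (n H) z)

module Projection
  (G H : Graph) (adj? : ∀ u v → Dec (Adj G u v))
  (c : Fin (n H) → Bool) (proper : ∀ h h' → Adj H h h' → c h ≢ c h')
  (f : Fin (n G * n H) → Fin 3) (f-trdf : IsTRDF (G ×ᵍ H) f)
  where

  F : Fin (n G) → Fin (n H) → ℕ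
  F y h = toℕ (f (combine y h))

  mass : Fin (n G) → Fin (n H) → ℕ
  mass u h = sum (λ y → 𝟙 (adj? u y) * F y h)

  mass-≥ : ∀ {u y} h → Adj G u y → F y h ≤ mass u h
  mass-≥ {u} {y} h uy =
    ≤-trans (𝟙-weighted (adj? u y) uy) (term≤sum (λ y → 𝟙 (adj? u y) * F y h) y)

  centre : Fin (n G) → Fin (n G) → Fin (n H) → Fin (n G)
  centre x x' h = if c h then x else x'

  -- Adjacent layers have opposite colours, hence swapped centres.
  centre-swap : ∀ x x' {h h'} → Adj H h h' → centre x x' h' ≡ centre x' x h
  centre-swap x x' {h} {h'} hh' with c h | c h' | proper h h' hh'
  ... | true  | true  | ≢ = contradiction refl ≢
  ... | true  | false | _ = refl
  ... | false | true  | _ = refl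
  ... | false | false | ≢ = contradiction refl ≢

  centre-edge : ∀ {x x'} h → Adj G x x' → Adj G (centre x x' h) (centre x' x h)
  centre-edge h xx' with c h
  ... | true  = xx'
  ... | false = Graph.sym G xx'

  module Edge (x x' : Fin (n G)) (xx' : Adj G x x') where

    g : Fin (n H) → Fin 3
    g h = cap (mass (centre x x' h) h)

    opposite-counted : ∀ h → F (centre x' x h) h ≤ mass (centre x x' h) h
    opposite-counted h = mass-≥ h (centre-edge h xx')

    -- Each G × H-neighbour of the opposite vertex of layer h is counted in the
    -- mass of an adjacent layer, whose centre is exactly that opposite vertex.
    transfer : ∀ h z → Adj (G ×ᵍ H) (combine (centre x' x h) h) z →
      Σ (Fin (n H)) λ h' → Adj H h h' × toℕ (f z) ≤ mass (centre x x' h') h'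
    transfer h z adj with product-neighbour G H (centre x' x h) h z adj
    ... | y' , h' , oy' , hh' , refl =
      h' , hh' , mass-≥ h' (subst (λ u → Adj G u y') (sym (centre-swap x x' hh')) oy')

    strong-neighbour : ∀ h → F (centre x' x h) h ≡ 0 →
      Σ (Fin (n H)) λ h' → Adj H h h' × toℕ (g h') ≡ 2
    strong-neighbour h F≡0 with proj₁ f-trdf (combine (centre x' x h) h) F≡0
    ... | z , adj , fz≡2 with transfer h z adj
    ... | h' , hh' , le =
      h' , hh' , cap-two (mass (centre x x' h') h') (subst (_≤ mass (centre x x' h') h') fz≡2 le)

    positive-neighbour : ∀ h → Σ (Fin (n H)) λ h' → Adj H h h' × toℕ (g h') ≢ 0
    positive-neighbour h with F (centre x' x h) h ≟ℕ 0
    ... | yes F≡0 with strong-neighbour h F≡0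
    ...   | h' , hh' , g≡2 = h' , hh' , λ g≡0 → 0≢1+n (trans (sym g≡0) g≡2)
    positive-neighbour h | no F≢0 with proj₂ f-trdf (combine (centre x' x h) h) F≢0
    ... | z , adj , fz≢0 with transfer h z adj
    ... | h' , hh' , le = h' , hh' , cap-positive _ (≤-trans (n≢0⇒n>0 fz≢0) le)

    -- g is a TRDF: a zero of g forces f to vanish at the opposite vertex.
    g-trdf : IsTRDF H g
    g-trdf = (λ h g≡0 → strong-neighbour h (n≤0⇒n≡0 (≤-trans (opposite-counted h)
                           (≤-reflexive (cap-zero _ g≡0)))))
           , (λ h _ → positive-neighbour h)

    g-weight : weight H g ≤ sum (λ h → mass (centre x x' h) h)
    g-weight = ≤-trans (≤-reflexive (weight≡sum g))
                       (sum-mono {ψ = λ h → mass (centre x x' h) h} (λ h → cap-≤ _))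

module Packing
  (G H : Graph) (adj? : ∀ u v → Dec (Adj G u v))
  (c : Fin (n H) → Bool) (proper : ∀ h h' → Adj H h h' → c h ≢ c h')
  (f : Fin (n G * n H) → Fin 3) (f-trdf : IsTRDF (G ×ᵍ H) f)
  (D : Subset (n G)) (D-packing : OpenPacking G D) (D-K₂ : InducesK₂Components G D)
  where

  open Projection G H adj? c proper f f-trdf

  -- The unique D-neighbour of a vertex of D (any value outside D).
  partner : Fin (n G) → Fin (n G)
  partner x with x ∈? D
  ... | yes x∈D = proj₁ (D-K₂ x x∈D)
  ... | no _    = x

  partner-adj : ∀ x → x ∈ D → Adj G x (partner x)
  partner-adj x x∈D with x ∈? D
  ... | yes x∈D' = proj₁ (proj₂ (proj₂ (D-K₂ x x∈D')))
  ... | no x∉D   = contradiction x∈D x∉D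

  partner-∈ : ∀ x → x ∈ D → partner x ∈ D
  partner-∈ x x∈D with x ∈? D
  ... | yes x∈D' = proj₁ (proj₂ (D-K₂ x x∈D'))
  ... | no x∉D   = contradiction x∈D x∉D

  -- Distinct members of D have distinct partners: both would be D-neighbours
  -- of the common partner, which has only one.
  partner-injective : ∀ x x' → x ∈ D → x' ∈ D → partner x ≡ partner x' → x ≡ x'
  partner-injective x x' x∈D x'∈D same
    with D-K₂ (partner x) (partner-∈ x x∈D)
  ... | _ , _ , _ , unique =
    trans (unique x x∈D (Graph.sym G (partner-adj x x∈D)))
          (sym (unique x' x'∈D (subst (λ u → Adj G u x') (sym same)
                                      (Graph.sym G (partner-adj x' x'∈D)))))

  centreᴰ : Fin (n G) → Fin (n H) → Fin (n G)
  centreᴰ x = centre x (partner x)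

  centreᴰ-∈ : ∀ x h → x ∈ D → centreᴰ x h ∈ D
  centreᴰ-∈ x h x∈D with c h
  ... | true  = x∈D
  ... | false = partner-∈ x x∈D

  centreᴰ-injective : ∀ x x' h → x ∈ D → x' ∈ D → centreᴰ x h ≡ centreᴰ x' h → x ≡ x'
  centreᴰ-injective x x' h x∈D x'∈D same with c h
  ... | true  = same
  ... | false = partner-injective x x' x∈D x'∈D same

  centres-disjoint : ∀ h x x' y → x ∈ D → x' ∈ D →
    Adj G (centreᴰ x h) y → Adj G (centreᴰ x' h) y → x ≡ x'
  centres-disjoint h x x' y x∈D x'∈D xy x'y with centreᴰ x h ≟ centreᴰ x' h
  ... | yes same = centreᴰ-injective x x' h x∈D x'∈D same
  ... | no differ = contradiction (xy , x'y)
                      (D-packing _ _ (centreᴰ-∈ x h x∈D) (centreᴰ-∈ x' h x'∈D) differ y)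

  layer-bound : ∀ k → (∀ g → IsTRDF H g → k ≤ weight H g) →
    ∀ x → x ∈ D → k ≤ sum (λ h → mass (centreᴰ x h) h)
  layer-bound k k-min x x∈D = ≤-trans (k-min g g-trdf) g-weight
    where open Edge x (partner x) (partner-adj x x∈D)

  packing-bound : ∀ k → (∀ g → IsTRDF H g → k ≤ weight H g) →
    ∣ D ∣ * k ≤ weight (G ×ᵍ H) f
  packing-bound k k-min = begin
      ∣ D ∣ * k
    ≡⟨ cong (_* k) (card≡sum D) ⟩
      sum (λ x → 𝟙 (x ∈? D)) * k
    ≡⟨ *-distribʳ-sum k (λ x → 𝟙 (x ∈? D)) ⟩
      sum (λ x → 𝟙 (x ∈? D) * k)
    ≤⟨ sum-mono (λ x → 𝟙-mono (x ∈? D) (layer-bound k k-min x)) ⟩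
      sum (λ x → 𝟙 (x ∈? D) * sum (λ h → mass (centreᴰ x h) h))
    ≡⟨ sum-cong-≗ (λ x → *-distribˡ-sum (𝟙 (x ∈? D)) (λ h → mass (centreᴰ x h) h)) ⟩
      sum (λ x → sum (λ h → 𝟙 (x ∈? D) * mass (centreᴰ x h) h))
    ≡⟨ ∑-comm (λ x h → 𝟙 (x ∈? D) * mass (centreᴰ x h) h) ⟩
      sum (λ h → sum (λ x → 𝟙 (x ∈? D) * mass (centreᴰ x h) h))
    ≤⟨ sum-mono (λ h → disjoint-sum (_∈? D) (λ x y → adj? (centreᴰ x h) y) (λ y → F y h)
                                    (centres-disjoint h)) ⟩
      sum (λ h → sum (λ y → F y h))
    ≡⟨ ∑-comm (λ h y → F y h) ⟩
      sum (λ y → sum (λ h → F y h))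
    ≡⟨ sum-combine (n G) (n H) (toℕ ∘ f) ⟨
      sum (toℕ ∘ f)
    ≡⟨ weight≡sum f ⟨
      weight (G ×ᵍ H) f ∎
    where open ≤-Reasoning

¬¬-decidable : ∀ {m n} (R : Fin m → Fin n → Set) → ¬ ¬ (∀ i j → Dec (R i j))
¬¬-decidable R =
  sequence ¬¬-applicative (λ i → sequence ¬¬-applicative (λ j → ¬¬-excluded-middle))
  where ¬¬-applicative = RawMonad.rawApplicative ¬¬-Monad

assume-decidable : ∀ {m n} {Q : Set} (R : Fin m → Fin n → Set) →
  Dec Q → ((∀ i j → Dec (R i j)) → Q) → Q
assume-decidable R Q? prove = decidable-stable Q? (λ ¬Q → ¬¬-decidable R (¬Q ∘ prove))

theorem9 : (G H : Graph) → TriangleFree G → NoIsolated G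
    → (p : ℕ) → Isρo G p
    → (Σ (Subset (n G)) λ D → OpenPacking G D × ∣ D ∣ ≡ p × InducesK₂Components G D)
    → Bipartite H → 2 ≤ n H → NoIsolated H
    → (k m : ℕ) → IsγtR H k → IsγtR (G ×ᵍ H) m
    → p * k ≤ m
theorem9 G H _ _ p _ (D , D-packing , ∣D∣≡p , D-K₂) (c , proper) _ _ k m
         (_ , k-min) ((f , f-trdf , wf≡m) , _) =
  assume-decidable (Adj G) (p * k ≤? m) λ adj? →
    subst₂ (λ q w → q * k ≤ w) ∣D∣≡p wf≡m
      (Packing.packing-bound G H adj? c proper f f-trdf D D-packing D-K₂ k k-min)
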